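{- Let $w\in S_n$ be a derangement with corresponding positroid $\mathcal{M}$, let $J=I_1(w)$, and suppose $a\in J$ and $b\notin J$. Then $I=(J\setminus\{a\})\cup\{b\}$ is in $\mathcal{M}$ if and only if $a<b$ and for every $r\in[a+1,b]$ the following two conditions hold: (1) there exists some $x\in[a,r-1]$ such that $w^{ -1}(x)\ge r$; (2) there exists some $y\in[r,b]$ such that $w^{ -1}(y)\le r-1$.
   Context: A derangement is a permutation with no fixed points. $[i,j]=\{i,i+1,\dots,j\}$. An element $i\in[n]$ is an anti-exceedance of $w$ if $i<w^{ -1}(i)$; $I_1(w)$ is the set of anti-exceedances, and $k=|I_1(w)|$. For $r\in[n]$ let $<_r$ be the order $r<_r r+1<_r\cdots<_r n<_r 1<_r\cdots<_r r-1$ and $I_r(w)=\{i: i<_r w^{ -1}(i)\}$. For $k$-subsets $I=\{i_1<_r\dots<_r i_k\}$, $J=\{j_1<_r\dots<_r j_k\}$, $I\preceq_r J$ means $i_h\le_r j_h$ for all $h$. The positroid of $w$ is $\mathcal{M}=\{I\subseteq[n],|I|=k: I_r(w)\preceq_r I\ \forall r\in[n]\}$. -}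

module Defs where

open import Data.Nat as ℕ using (ℕ; _+_; _∸_)
open import Data.Fin as Fin using (Fin; toℕ)
open import Data.Fin.Properties using (_<?_; _≤?_)
open import Data.Fin.Permutation using (Permutation′; _⟨$⟩ʳ_; _⟨$⟩ˡ_)
open import Data.Fin.Subset using (Subset; _∈_; _∉_; ∣_∣; _∪_; _-_; ⁅_⁆)
open import Data.Fin.Subset.Properties using (_∈?_)
open import Data.Vec using (tabulate)
open import Data.List using (List; filter; _++_; allFin)
open import Data.List.Relation.Binary.Pointwise using (Pointwise)
open import Relation.Nullary using (¬_; does; yes; no)

open import Relation.Binary.PropositionalEquality using (_≢_)

-- Elements of [n] = {1,…,n} are represented by Fin n (i ↦ toℕ i + 1);
-- the natural order on Fin n is the natural order on [n].

-- A permutation w ∈ S_n: w ⟨$⟩ʳ i is w(i), w ⟨$⟩ˡ i is w⁻¹(i).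
IsDerangement : ∀ {n} → Permutation′ n → Set
IsDerangement {n} w = ∀ (i : Fin n) → w ⟨$⟩ʳ i ≢ i

-- Position of i in the order <_r : r <_r r+1 <_r … <_r n <_r 1 <_r … <_r r-1.
rank : ∀ {n} → Fin n → Fin n → ℕ
rank {n} r i with toℕ r ℕ.≤? toℕ i
... | yes _ = toℕ i ∸ toℕ r
... | no _  = toℕ i + n ∸ toℕ r

_<[_]_ : ∀ {n} → Fin n → Fin n → Fin n → Set
i <[ r ] j = rank r i ℕ.< rank r j

_≤[_]_ : ∀ {n} → Fin n → Fin n → Fin n → Set
i ≤[ r ] j = rank r i ℕ.≤ rank r j

Ir : ∀ {n} → Permutation′ n → Fin n → Subset n
Ir w r = tabulate (λ i → does (rank r i ℕ.<? rank r (w ⟨$⟩ˡ i)))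

I₁ : ∀ {n} → Permutation′ n → Subset n
I₁ w = tabulate (λ i → does (i <? (w ⟨$⟩ˡ i)))

orderR : ∀ {n} → Fin n → List (Fin n)
orderR {n} r = filter (λ i → r ≤? i) (allFin n) ++ filter (λ i → i <? r) (allFin n)

sortedR : ∀ {n} → Fin n → Subset n → List (Fin n)
sortedR r I = filter (λ i → i ∈? I) (orderR r)

_⪯[_]_ : ∀ {n} → Subset n → Fin n → Subset n → Set
I ⪯[ r ] J = Pointwise (λ x y → x ≤[ r ] y) (sortedR r I) (sortedR r J)

_∈Positroid_ : ∀ {n} → Subset n → Permutation′ n → Set
I ∈Positroid w = (∣ I ∣ Relation.Binary.PropositionalEquality.≡ ∣ I₁ w ∣) × (∀ r → Ir w r ⪯[ r ] I)
  where open import Data.Product using (_×_)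

{-# OPTIONS --safe #-}
-- Let J = I₁(w). The set I_r(w) arises from J by removing the z < r with
-- w⁻¹(z) ≥ r and adding the z ≥ r with w⁻¹(z) < r; as w⁻¹ permutes [n], there
-- are as many removed as added elements (they are the two directions in which
-- w crosses the cut in front of r). For sorted sets of equal size, the Gale
-- order ⪯_r says that every initial segment F of <_r meets I_r(w) at least as
-- often as I; for I = (J ∖ {a}) ∪ {b} this becomes
--   [b ∈ F] + #(removed elements in F) ≤ [a ∈ F] + #(added elements in F).
-- Either F ⊆ [r, n], and then no removed element lies in F, or F ⊇ [r, n], and
-- then every added element does. So the inequality can only fail when b ∈ F and
-- a ∉ F, which for a < b forces a < r ≤ b; then condition (2) provides an added
-- element in F, respectively (1) a removed element outside F. Conversely the
-- segments ending at b and just before a, and the order <_1, extract (2), (1)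
-- and a < b.

module Submission where

open import Defs

open import Data.Bool using (Bool; true; false; if_then_else_)
open import Data.Fin as Fin using (Fin; zero; suc; toℕ; _≤?_; _<?_)
import Data.Fin.Properties as Finₚ
open import Data.Fin.Permutation using (Permutation′; _⟨$⟩ˡ_)
import Data.Fin.Permutation as Perm
open import Data.Fin.Subset using (Subset; _∈_; _∉_; _∪_; _-_; ⁅_⁆; ∣_∣; inside; outside)
open import Data.Fin.Subset.Properties
  using (_∈?_; x∈p∪q⁻; x∈p∪q⁺; x∈⁅x⁆; x∈⁅y⁆⇒x≡y; p─q⊆p; x∈p∧x≢y⇒x∈p-y; drop-there)
open import Data.List using (List; []; _∷_; _++_; filter; length; tabulate; allFin)
open import Data.List.Properties using (length-++; filter-++; filter-none; filter-accept; filter-reject)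
open import Data.List.Relation.Unary.All as All using (All; []; _∷_)
open import Data.List.Relation.Unary.All.Properties using (all-filter)
open import Data.List.Relation.Unary.AllPairs using (AllPairs; []; _∷_)
import Data.List.Relation.Unary.AllPairs.Properties as AllPairsₚ
open import Data.List.Relation.Binary.Pointwise as Pointwise using (Pointwise; []; _∷_)
open import Data.Nat as ℕ using (ℕ; zero; suc; _+_; _*_; _≤_; _<_; z≤n; s≤s; s≤s⁻¹)
open import Data.Nat.Properties hiding (_≤?_; _<?_)
open import Data.Product using (_×_; _,_; ∃-syntax; proj₁; proj₂)
open import Data.Sum using (inj₁; inj₂; [_,_]′)
open import Data.Vec using ([]; _∷_)
import Data.Vec as Vec
open import Function using (_∘_)
open import Function.Bundles using (_⇔_; mk⇔; Equivalence)
import Function.Properties.Equivalence as ⇔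
open import Level using (Level; 0ℓ)
open import Relation.Nullary using (Dec; does; yes; no; ¬_; _×-dec_; contradiction)
open import Relation.Nullary.Decidable using (dec-true; dec-false)
open import Relation.Unary using (Pred; Decidable)
open import Relation.Unary.Properties using (_∩?_)
open import Relation.Binary.PropositionalEquality hiding (J)

open import Algebra.Properties.CommutativeMonoid.Sum +-0-commutativeMonoid
  using (sum; sum-syntax; sum-cong-≗; ∑-distrib-+; sum-replicate-zero; sum-permute)

private variable
  p q : Level
  P Q : Set p
  n : ℕ

𝟙 : Dec P → ℕ
𝟙 d = if does d then 1 else 0

𝟙-yes : (d : Dec P) → P → 𝟙 d ≡ 1
𝟙-yes d x rewrite dec-true d x = refl

𝟙-no : (d : Dec P) → ¬ P → 𝟙 d ≡ 0
𝟙-no d ¬x rewrite dec-false d ¬x = refl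

𝟙-pos : (d : Dec P) → 0 < 𝟙 d → P
𝟙-pos (yes x) _ = x

𝟙-× : (d : Dec P) (e : Dec Q) → 𝟙 (d ×-dec e) ≡ 𝟙 d * 𝟙 e
𝟙-× (yes _) (yes _) = refl
𝟙-× (yes _) (no _)  = refl
𝟙-× (no _)  e       = refl

𝟙-×≤ : (d : Dec P) (e : Dec Q) → 𝟙 (d ×-dec e) ≤ 𝟙 d
𝟙-×≤ (yes _) (yes _) = ≤-refl
𝟙-×≤ (yes _) (no _)  = z≤n
𝟙-×≤ (no _)  e       = ≤-refl

𝟙-cong : (d : Dec P) (e : Dec Q) → P ⇔ Q → 𝟙 d ≡ 𝟙 e
𝟙-cong (yes _) (yes _) _   = refl
𝟙-cong (yes x) (no ¬y) P⇔Q = contradiction (Equivalence.to P⇔Q x) ¬y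
𝟙-cong (no ¬x) (yes y) P⇔Q = contradiction (Equivalence.from P⇔Q y) ¬x
𝟙-cong (no _)  (no _)  _   = refl

∑-mono-≤ : {f g : Fin n → ℕ} → (∀ z → f z ≤ g z) → sum f ≤ sum g
∑-mono-≤ {zero}  f≤g = z≤n
∑-mono-≤ {suc n} f≤g = +-mono-≤ (f≤g zero) (∑-mono-≤ (f≤g ∘ suc))

∑-mono-< : {f g : Fin n → ℕ} → (∀ z → f z ≤ g z) → ∀ y → f y < g y → sum f < sum g
∑-mono-< f≤g zero    fy<gy = +-mono-<-≤ fy<gy (∑-mono-≤ (f≤g ∘ suc))
∑-mono-< f≤g (suc y) fy<gy = +-mono-≤-< (f≤g zero) (∑-mono-< (f≤g ∘ suc) y fy<gy)

∑<∑⇒∃< : {f g : Fin n → ℕ} → sum f < sum g → ∃[ z ] f z < g z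
∑<∑⇒∃< {suc n} {f} {g} ∑f<∑g with f zero ℕ.<? g zero
... | yes f₀<g₀ = zero , f₀<g₀
... | no  f₀≮g₀ =
  let z , fz<gz = ∑<∑⇒∃< (+-cancelˡ-< (f zero) _ _ (<-≤-trans ∑f<∑g (+-monoˡ-≤ _ (≮⇒≥ f₀≮g₀))))
  in suc z , fz<gz

term≤∑ : {f : Fin n → ℕ} → ∀ y → f y ≤ sum f
term≤∑ zero    = m≤m+n _ _
term≤∑ (suc y) = ≤-trans (term≤∑ y) (m≤n+m _ _)

count : {P : Pred (Fin n) p} → Decidable P → ℕ
count {n} P? = ∑[ z < n ] 𝟙 (P? z)

module _ {P : Pred (Fin n) p} (P? : Decidable P) where

  0<count⇒∃ : 0 < count P? → ∃[ z ] P z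
  0<count⇒∃ 0<count with ∑<∑⇒∃< (subst (_< count P?) (sym (sum-replicate-zero n)) 0<count)
  ... | z , 0<𝟙 = z , 𝟙-pos (P? z) 0<𝟙

  1≤count : ∀ {z} → P z → 1 ≤ count P?
  1≤count {z} Pz = ≤-trans (≤-reflexive (sym (𝟙-yes (P? z) Pz))) (term≤∑ z)

  module _ {Q : Pred (Fin n) q} (Q? : Decidable Q) where

    count-∩≤ : count (P? ∩? Q?) ≤ count P?
    count-∩≤ = ∑-mono-≤ (λ z → 𝟙-×≤ (P? z) (Q? z))

    count-∩<⇒∃ : count (P? ∩? Q?) < count P? → ∃[ z ] P z × ¬ Q z
    count-∩<⇒∃ lt with ∑<∑⇒∃< lt
    ... | z , lt′ with P? z | Q? z | lt′
    ...   | yes Pz | no ¬Qz | _      = z , Pz , ¬Qz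
    ...   | yes _  | yes _  | s≤s ()

    count-∩< : ∀ {z} → P z → ¬ Q z → count (P? ∩? Q?) < count P?
    count-∩< {z} Pz ¬Qz = ∑-mono-< (λ x → 𝟙-×≤ (P? x) (Q? x)) z (𝟙-×< (P? z) (Q? z))
      where
      𝟙-×< : (d : Dec (P z)) (e : Dec (Q z)) → 𝟙 (d ×-dec e) < 𝟙 d
      𝟙-×< (yes _) (no _)  = s≤s z≤n
      𝟙-×< (yes _) (yes q) = contradiction q ¬Qz
      𝟙-×< (no ¬p) _       = contradiction Pz ¬p

count-linear : {P Q R S : Pred (Fin n) p}
               (P? : Decidable P) (Q? : Decidable Q) (R? : Decidable R) (S? : Decidable S) →
               (∀ z → 𝟙 (P? z) + 𝟙 (Q? z) ≡ 𝟙 (R? z) + 𝟙 (S? z)) →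
               count P? + count Q? ≡ count R? + count S?
count-linear {n} P? Q? R? S? eq = begin
  count P? + count Q?                 ≡⟨ ∑-distrib-+ (𝟙 ∘ P?) (𝟙 ∘ Q?) ⟨
  ∑[ z < n ] (𝟙 (P? z) + 𝟙 (Q? z))    ≡⟨ sum-cong-≗ eq ⟩
  ∑[ z < n ] (𝟙 (R? z) + 𝟙 (S? z))    ≡⟨ ∑-distrib-+ (𝟙 ∘ R?) (𝟙 ∘ S?) ⟩
  count R? + count S?                 ∎
  where open ≡-Reasoning

count-linear-∩ : {P Q R S : Pred (Fin n) p}
                 (P? : Decidable P) (Q? : Decidable Q) (R? : Decidable R) (S? : Decidable S) →
                 (∀ z → 𝟙 (P? z) + 𝟙 (Q? z) ≡ 𝟙 (R? z) + 𝟙 (S? z)) →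
                 ∀ {W : Pred (Fin n) q} (W? : Decidable W) →
                 count (P? ∩? W?) + count (Q? ∩? W?) ≡ count (R? ∩? W?) + count (S? ∩? W?)
count-linear-∩ P? Q? R? S? eq W? = count-linear (P? ∩? W?) (Q? ∩? W?) (R? ∩? W?) (S? ∩? W?) λ z →
  let w = 𝟙 (W? z) in begin
  𝟙 (P? z ×-dec W? z) + 𝟙 (Q? z ×-dec W? z)  ≡⟨ cong₂ _+_ (𝟙-× (P? z) (W? z)) (𝟙-× (Q? z) (W? z)) ⟩
  𝟙 (P? z) * w + 𝟙 (Q? z) * w                ≡⟨ *-distribʳ-+ w (𝟙 (P? z)) _ ⟨
  (𝟙 (P? z) + 𝟙 (Q? z)) * w                  ≡⟨ cong (_* w) (eq z) ⟩
  (𝟙 (R? z) + 𝟙 (S? z)) * w                  ≡⟨ *-distribʳ-+ w (𝟙 (R? z)) _ ⟩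
  𝟙 (R? z) * w + 𝟙 (S? z) * w                ≡⟨ cong₂ _+_ (𝟙-× (R? z) (W? z)) (𝟙-× (S? z) (W? z)) ⟨
  𝟙 (R? z ×-dec W? z) + 𝟙 (S? z ×-dec W? z)  ∎
  where open ≡-Reasoning

count-≟∩ : (a : Fin n) {W : Pred (Fin n) p} (W? : Decidable W) → count ((Finₚ._≟ a) ∩? W?) ≡ 𝟙 (W? a)
count-≟∩ {suc n} zero    W? = trans (cong (𝟙 (W? zero) +_) (sum-replicate-zero n)) (+-identityʳ _)
count-≟∩ {suc n} (suc a) W? = count-≟∩ a (W? ∘ suc)

count-≟ : (a : Fin n) → count (Finₚ._≟ a) ≡ 1
count-≟ {suc n} zero    = cong suc (sum-replicate-zero n)
count-≟ {suc n} (suc a) = count-≟ a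

module _ {P : Pred (Fin n) p} (P? : Decidable P) where

  count-none : (∀ z → ¬ P z) → count P? ≡ 0
  count-none ¬P = trans (sum-cong-≗ (λ z → 𝟙-no (P? z) (¬P z))) (sum-replicate-zero n)

  ⊆⇒count-∩≡count : ∀ {Q : Pred (Fin n) q} (Q? : Decidable Q) → (∀ {z} → P z → Q z) →
                    count (P? ∩? Q?) ≡ count P?
  ⊆⇒count-∩≡count Q? P⇒Q =
    sum-cong-≗ (λ z → 𝟙-cong (P? z ×-dec Q? z) (P? z) (mk⇔ proj₁ (λ Pz → Pz , P⇒Q Pz)))

module Gale {a} {A : Set a} (key : A → ℕ) where

  Increasing : List A → Set a
  Increasing = AllPairs (λ x y → key x < key y)

  _≼_ : List A → List A → Set a
  _≼_ = Pointwise (λ x y → key x ≤ key y)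

  below : ℕ → List A → ℕ
  below t xs = length (filter (λ x → key x ℕ.<? t) xs)

  private
    below-∷-yes : ∀ {t x} xs → key x < t → below t (x ∷ xs) ≡ suc (below t xs)
    below-∷-yes {t} xs x<t = cong length (filter-accept (λ x → key x ℕ.<? t) {xs = xs} x<t)

    below-∷-no : ∀ {t x} xs → ¬ key x < t → below t (x ∷ xs) ≡ below t xs
    below-∷-no {t} xs x≮t = cong length (filter-reject (λ x → key x ℕ.<? t) {xs = xs} x≮t)

    below-∷≤ : ∀ t x xs → below t (x ∷ xs) ≤ suc (below t xs)
    below-∷≤ t x xs with key x ℕ.<? t
    ... | yes x<t = ≤-reflexive (below-∷-yes xs x<t)
    ... | no  x≮t = ≤-trans (≤-reflexive (below-∷-no xs x≮t)) (n≤1+n _)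

    below-∷≥ : ∀ t x xs → below t xs ≤ below t (x ∷ xs)
    below-∷≥ t x xs with key x ℕ.<? t
    ... | yes x<t = ≤-trans (n≤1+n _) (≤-reflexive (sym (below-∷-yes xs x<t)))
    ... | no  x≮t = ≤-reflexive (sym (below-∷-no xs x≮t))

    below-above : ∀ {t xs} → All (λ x → t ≤ key x) xs → below t xs ≡ 0
    below-above {t} t≤xs = cong length (filter-none (λ x → key x ℕ.<? t) (All.map ≤⇒≯ t≤xs))

  ≼⇒below≥ : ∀ {xs ys} → xs ≼ ys → ∀ t → below t ys ≤ below t xs
  ≼⇒below≥ [] t = z≤n
  ≼⇒below≥ {x ∷ xs} {y ∷ ys} (x≤y ∷ xs≼ys) t with key y ℕ.<? t
  ... | yes y<t = begin
    below t (y ∷ ys)  ≡⟨ below-∷-yes ys y<t ⟩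
    suc (below t ys)  ≤⟨ s≤s (≼⇒below≥ xs≼ys t) ⟩
    suc (below t xs)  ≡⟨ below-∷-yes xs (≤-<-trans x≤y y<t) ⟨
    below t (x ∷ xs)  ∎
    where open ≤-Reasoning
  ... | no  y≮t = begin
    below t (y ∷ ys)  ≡⟨ below-∷-no ys y≮t ⟩
    below t ys        ≤⟨ ≼⇒below≥ xs≼ys t ⟩
    below t xs        ≤⟨ below-∷≥ t x xs ⟩
    below t (x ∷ xs)  ∎
    where open ≤-Reasoning

  below≥⇒≼ : ∀ {xs ys} → Increasing xs → Increasing ys → length xs ≡ length ys →
             (∀ t → below t ys ≤ below t xs) → xs ≼ ys
  below≥⇒≼ {[]}     {[]}     _ _ _ _ = []
  below≥⇒≼ {x ∷ xs} {y ∷ ys} (x<xs ∷ ↑xs) (y<ys ∷ ↑ys) |xs|≡|ys| ys≤xs =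
    ≮⇒≥ y≮x ∷ below≥⇒≼ ↑xs ↑ys (suc-injective |xs|≡|ys|) tail
    where
    y≮x : ¬ key y < key x
    y≮x y<x = contradiction (ys≤xs (suc (key y))) (<⇒≱ (begin-strict
      below (suc (key y)) (x ∷ xs)   ≡⟨ below-above (y<x ∷ All.map (<-trans y<x) x<xs) ⟩
      0                              <⟨ s≤s z≤n ⟩
      suc (below (suc (key y)) ys)   ≡⟨ below-∷-yes ys ≤-refl ⟨
      below (suc (key y)) (y ∷ ys)   ∎))
      where open ≤-Reasoning
    tail : ∀ t → below t ys ≤ below t xs
    tail t with key y ℕ.<? t
    ... | yes y<t = s≤s⁻¹ (begin
      suc (below t ys)  ≡⟨ below-∷-yes ys y<t ⟨
      below t (y ∷ ys)  ≤⟨ ys≤xs t ⟩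
      below t (x ∷ xs)  ≤⟨ below-∷≤ t x xs ⟩
      suc (below t xs)  ∎)
      where open ≤-Reasoning
    ... | no  y≮t = subst (_≤ below t xs) (sym (below-above (All.map (<⇒≤ ∘ ≤-<-trans (≮⇒≥ y≮t)) y<ys))) z≤n

  ≼⇔length≡×below≥ : ∀ {xs ys} → Increasing xs → Increasing ys →
                     xs ≼ ys ⇔ (length xs ≡ length ys × ∀ t → below t ys ≤ below t xs)
  ≼⇔length≡×below≥ ↑xs ↑ys = mk⇔ (λ xs≼ys → Pointwise.Pointwise-length xs≼ys , ≼⇒below≥ xs≼ys)
                                  (λ (|xs|≡|ys| , ys≤xs) → below≥⇒≼ ↑xs ↑ys |xs|≡|ys| ys≤xs)

length-filter-filter : ∀ {a p q} {A : Set a} {P : Pred A p} {Q : Pred A q}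
                       (P? : Decidable P) (Q? : Decidable Q) xs →
                       length (filter Q? (filter P? xs)) ≡ length (filter (P? ∩? Q?) xs)
length-filter-filter P? Q? [] = refl
length-filter-filter P? Q? (x ∷ xs) with P? x
... | no  _ = length-filter-filter P? Q? xs
... | yes _ with Q? x
...   | yes _ = cong suc (length-filter-filter P? Q? xs)
...   | no  _ = length-filter-filter P? Q? xs

length-filter-allFin : ∀ {p} {P : Pred (Fin n) p} (P? : Decidable P) →
                       length (filter P? (allFin n)) ≡ count P?
length-filter-allFin {n} P? = go (λ i → i)
  where
  go : ∀ {m} (f : Fin m → Fin n) → length (filter P? (tabulate f)) ≡ ∑[ i < m ] 𝟙 (P? (f i))
  go {zero}  f = refl
  go {suc m} f with P? (f zero)
  ... | yes _ = cong suc (go (f ∘ suc))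
  ... | no  _ = go (f ∘ suc)

AllPairs-restrict : ∀ {a p r s} {A : Set a} {P : Pred A p} {R : A → A → Set r} {S : A → A → Set s} →
                    (∀ {x y} → P x → P y → R x y → S x y) →
                    ∀ {xs} → All P xs → AllPairs R xs → AllPairs S xs
AllPairs-restrict R⇒S []         []           = []
AllPairs-restrict R⇒S (px ∷ pxs) (Rx ∷ Rxs) =
  All.zipWith (λ (py , Rxy) → R⇒S px py Rxy) (pxs , Rx) ∷ AllPairs-restrict R⇒S pxs Rxs

First : Fin n → ℕ → Pred (Fin n) 0ℓ
First r t z = rank r z < t

first? : (r : Fin n) (t : ℕ) → Decidable (First r t)
first? r t z = rank r z ℕ.<? t

∣∣≡count : (X : Subset n) → ∣ X ∣ ≡ count (_∈? X)
∣∣≡count []            = refl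
∣∣≡count (inside ∷ X)  = cong suc (∣∣≡count X)
∣∣≡count (outside ∷ X) = ∣∣≡count X

module _ {n} (r : Fin n) where

  open Gale (rank r)

  rank-≥ : ∀ {z} → r Fin.≤ z → rank r z + toℕ r ≡ toℕ z
  rank-≥ {z} r≤z with toℕ r ℕ.≤? toℕ z
  ... | yes _   = m∸n+n≡m r≤z
  ... | no r≰z = contradiction r≤z r≰z

  rank-< : ∀ {z} → z Fin.< r → rank r z + toℕ r ≡ toℕ z + n
  rank-< {z} z<r with toℕ r ℕ.≤? toℕ z
  ... | yes r≤z = contradiction r≤z (<⇒≱ z<r)
  ... | no  _   = m∸n+n≡m (≤-trans (<⇒≤ (Finₚ.toℕ<n r)) (m≤n+m n (toℕ z)))

  private
    shift-<⇔ : ∀ {m m′ k x x′} → m + k ≡ x → m′ + k ≡ x′ → m < m′ ⇔ x < x′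
    shift-<⇔ {k = k} refl refl = mk⇔ (+-monoˡ-< k) (+-cancelʳ-< k _ _)

  rank-<⇔-≥ : ∀ {z z′} → r Fin.≤ z → r Fin.≤ z′ → rank r z < rank r z′ ⇔ z Fin.< z′
  rank-<⇔-≥ r≤z r≤z′ = shift-<⇔ (rank-≥ r≤z) (rank-≥ r≤z′)

  rank-<⇔-< : ∀ {z z′} → z Fin.< r → z′ Fin.< r → rank r z < rank r z′ ⇔ z Fin.< z′
  rank-<⇔-< z<r z′<r = ⇔.trans (shift-<⇔ (rank-< z<r) (rank-< z′<r)) (mk⇔ (+-cancelʳ-< n _ _) (+-monoˡ-< n))

  rank-wrap : ∀ {z z′} → r Fin.≤ z → z′ Fin.< r → rank r z < rank r z′
  rank-wrap {z} {z′} r≤z z′<r = Equivalence.from (shift-<⇔ (rank-≥ r≤z) (rank-< z′<r))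
    (<-≤-trans (Finₚ.toℕ<n z) (m≤n+m n (toℕ z′)))

  rank-≤⇔-≥ : ∀ {z z′} → r Fin.≤ z → r Fin.≤ z′ → rank r z ≤ rank r z′ ⇔ z Fin.≤ z′
  rank-≤⇔-≥ r≤z r≤z′ = mk⇔
    (λ rz≤rz′ → ≮⇒≥ (λ z′<z → <⇒≱ (Equivalence.from (rank-<⇔-≥ r≤z′ r≤z) z′<z) rz≤rz′))
    (λ z≤z′ → ≮⇒≥ (λ rz′<rz → <⇒≱ (Equivalence.to (rank-<⇔-≥ r≤z′ r≤z) rz′<rz) z≤z′))

  rank-≤⇔-< : ∀ {z z′} → z Fin.< r → z′ Fin.< r → rank r z ≤ rank r z′ ⇔ z Fin.≤ z′
  rank-≤⇔-< z<r z′<r = mk⇔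
    (λ rz≤rz′ → ≮⇒≥ (λ z′<z → <⇒≱ (Equivalence.from (rank-<⇔-< z′<r z<r) z′<z) rz≤rz′))
    (λ z≤z′ → ≮⇒≥ (λ rz′<rz → <⇒≱ (Equivalence.to (rank-<⇔-< z′<r z<r) rz′<rz) z≤z′))

  rank-<-inversion : ∀ {z z′} → z Fin.< z′ → rank r z′ < rank r z → z Fin.< r × r Fin.≤ z′
  rank-<-inversion {z} {z′} z<z′ rz′<rz with z <? r | z′ <? r
  ... | no z≮r  | _        = contradiction rz′<rz
    (<-asym (Equivalence.from (rank-<⇔-≥ (≮⇒≥ z≮r) (≤-trans (≮⇒≥ z≮r) (<⇒≤ z<z′))) z<z′))
  ... | yes z<r | yes z′<r = contradiction rz′<rz (<-asym (Equivalence.from (rank-<⇔-< z<r z′<r) z<z′))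
  ... | yes z<r | no z′≮r  = z<r , ≮⇒≥ z′≮r

  first-short : ∀ {t} → toℕ r + t ≤ n → ∀ {z} → First r t z → r Fin.≤ z
  first-short {t} r+t≤n {z} rz<t = ≮⇒≥ λ z<r → <⇒≱ rz<t (+-cancelʳ-≤ (toℕ r) t (rank r z) (begin
    t + toℕ r        ≡⟨ +-comm t (toℕ r) ⟩
    toℕ r + t        ≤⟨ r+t≤n ⟩
    n                ≤⟨ m≤n+m n (toℕ z) ⟩
    toℕ z + n        ≡⟨ rank-< z<r ⟨
    rank r z + toℕ r ∎))
    where open ≤-Reasoning

  first-long : ∀ {t} → n ≤ toℕ r + t → ∀ {z} → r Fin.≤ z → First r t z
  first-long {t} n≤r+t {z} r≤z = +-cancelʳ-< (toℕ r) (rank r z) t (begin-strict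
    rank r z + toℕ r ≡⟨ rank-≥ r≤z ⟩
    toℕ z            <⟨ Finₚ.toℕ<n z ⟩
    n                ≤⟨ n≤r+t ⟩
    toℕ r + t        ≡⟨ +-comm (toℕ r) t ⟩
    t + toℕ r        ∎)
    where open ≤-Reasoning

  private
    above = filter (r ≤?_) (allFin n)
    under = filter (_<? r) (allFin n)

    increasing-filter : ∀ {p} {P : Pred (Fin n) p} (P? : Decidable P) →
                        (∀ {x y} → P x → P y → x Fin.< y → rank r x < rank r y) →
                        Increasing (filter P? (allFin n))
    increasing-filter P? mono = AllPairs-restrict mono (all-filter P? (allFin n))
      (AllPairsₚ.filter⁺ P? (AllPairsₚ.tabulate⁺-< (λ i<j → i<j)))

  orderR-increasing : Increasing (orderR r)
  orderR-increasing = AllPairsₚ.++⁺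
    (increasing-filter (r ≤?_) (λ r≤x r≤y → Equivalence.from (rank-<⇔-≥ r≤x r≤y)))
    (increasing-filter (_<? r) (λ x<r y<r → Equivalence.from (rank-<⇔-< x<r y<r)))
    (All.map (λ r≤x → All.map (rank-wrap r≤x) (all-filter (_<? r) (allFin n)))
             (all-filter (r ≤?_) (allFin n)))

  length-filter-orderR : ∀ {p} {P : Pred (Fin n) p} (P? : Decidable P) →
                         length (filter P? (orderR r)) ≡ count P?
  length-filter-orderR {p} P? = begin
    length (filter P? (above ++ under))
      ≡⟨ cong length (filter-++ P? above under) ⟩
    length (filter P? above ++ filter P? under)
      ≡⟨ length-++ (filter P? above) ⟩
    length (filter P? above) + length (filter P? under)
      ≡⟨ cong₂ _+_ (length-filter-filter (r ≤?_) P? (allFin n)) (length-filter-filter (_<? r) P? (allFin n)) ⟩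
    length (filter ((r ≤?_) ∩? P?) (allFin n)) + length (filter ((_<? r) ∩? P?) (allFin n))
      ≡⟨ cong₂ _+_ (length-filter-allFin ((r ≤?_) ∩? P?)) (length-filter-allFin ((_<? r) ∩? P?)) ⟩
    count ((r ≤?_) ∩? P?) + count ((_<? r) ∩? P?)
      ≡⟨ ∑-distrib-+ (𝟙 ∘ ((r ≤?_) ∩? P?)) (𝟙 ∘ ((_<? r) ∩? P?)) ⟨
    ∑[ z < n ] (𝟙 ((r ≤? z) ×-dec P? z) + 𝟙 ((z <? r) ×-dec P? z))
      ≡⟨ sum-cong-≗ split ⟩
    count P? ∎
    where
    open ≡-Reasoning
    split : ∀ z → 𝟙 ((r ≤? z) ×-dec P? z) + 𝟙 ((z <? r) ×-dec P? z) ≡ 𝟙 (P? z)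
    split z = complementary (r ≤? z) (z <? r) (P? z)
      where
      complementary : ∀ (d : Dec (r Fin.≤ z)) (e : Dec (z Fin.< r)) {Q : Set p} (f : Dec Q) →
                      𝟙 (d ×-dec f) + 𝟙 (e ×-dec f) ≡ 𝟙 f
      complementary (yes _)   (no _)    f = +-identityʳ (𝟙 f)
      complementary (no _)    (yes _)   f = refl
      complementary (yes r≤z) (yes z<r) f = contradiction r≤z (<⇒≱ z<r)
      complementary (no r≰z)  (no z≮r)  f = contradiction (≮⇒≥ z≮r) r≰z

  sortedR-increasing : ∀ X → Increasing (sortedR r X)
  sortedR-increasing X = AllPairsₚ.filter⁺ (_∈? X) orderR-increasing

  below-sortedR : ∀ t X → below t (sortedR r X) ≡ count ((_∈? X) ∩? first? r t)
  below-sortedR t X = trans (length-filter-filter (_∈? X) (first? r t) (orderR r))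
                            (length-filter-orderR ((_∈? X) ∩? first? r t))

  ⪯⇔∣∣≡×count≥ : ∀ X Y → X ⪯[ r ] Y ⇔
                 (∣ X ∣ ≡ ∣ Y ∣ × ∀ t → count ((_∈? Y) ∩? first? r t) ≤ count ((_∈? X) ∩? first? r t))
  ⪯⇔∣∣≡×count≥ X Y = ⇔.trans (≼⇔length≡×below≥ (sortedR-increasing X) (sortedR-increasing Y))
    (mk⇔ (λ (|X|≡|Y| , below≥) → trans (sym (length-sortedR X)) (trans |X|≡|Y| (length-sortedR Y)) ,
                                  λ t → subst₂ _≤_ (below-sortedR t Y) (below-sortedR t X) (below≥ t))
         (λ (|X|≡|Y| , count≥) → trans (length-sortedR X) (trans |X|≡|Y| (sym (length-sortedR Y))) ,
                                  λ t → subst₂ _≤_ (sym (below-sortedR t Y)) (sym (below-sortedR t X)) (count≥ t)))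
    where
    length-sortedR : ∀ X → length (sortedR r X) ≡ ∣ X ∣
    length-sortedR X = trans (length-filter-orderR (_∈? X)) (sym (∣∣≡count X))

does-∈?-tabulate : (f : Fin n → Bool) (z : Fin n) → does (z ∈? Vec.tabulate f) ≡ f z
does-∈?-tabulate f zero with f zero
... | true  = refl
... | false = refl
does-∈?-tabulate f (suc z) = does-∈?-tabulate (f ∘ suc) z

𝟙-∈?-tabulate : ∀ {P : Pred (Fin n) 0ℓ} (P? : Decidable P) z →
                𝟙 (z ∈? Vec.tabulate (λ i → does (P? i))) ≡ 𝟙 (P? z)
𝟙-∈?-tabulate P? z = cong (λ b → if b then 1 else 0) (does-∈?-tabulate (λ i → does (P? i)) z)

x∉p-x : (p : Subset n) (x : Fin n) → x ∉ p - x
x∉p-x (_ ∷ p) zero    ()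
x∉p-x (_ ∷ p) (suc x) x∈p-x = x∉p-x p x (drop-there x∈p-x)

module _ {J : Subset n} {a b : Fin n} (a∈J : a ∈ J) (b∉J : b ∉ J) where

  private
    a∉J-a∪b : a ∉ (J - a) ∪ ⁅ b ⁆
    a∉J-a∪b a∈ with x∈p∪q⁻ (J - a) ⁅ b ⁆ a∈
    ... | inj₁ a∈J-a = x∉p-x J a a∈J-a
    ... | inj₂ a∈⁅b⁆ = b∉J (subst (_∈ J) (x∈⁅y⁆⇒x≡y b a∈⁅b⁆) a∈J)

  exchange-indicator : ∀ z → 𝟙 (z ∈? (J - a) ∪ ⁅ b ⁆) + 𝟙 (z Finₚ.≟ a) ≡ 𝟙 (z ∈? J) + 𝟙 (z Finₚ.≟ b)
  exchange-indicator z with z Finₚ.≟ a | z Finₚ.≟ b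
  ... | yes refl | yes refl = contradiction a∈J b∉J
  ... | yes refl | no  _    = trans (cong (_+ 1) (𝟙-no (z ∈? _) a∉J-a∪b))
                                    (cong (_+ 0) (sym (𝟙-yes (z ∈? J) a∈J)))
  ... | no  _    | yes refl = trans (cong (_+ 0) (𝟙-yes (z ∈? _) (x∈p∪q⁺ (inj₂ (x∈⁅x⁆ b)))))
                                    (cong (_+ 1) (sym (𝟙-no (z ∈? J) b∉J)))
  ... | no  z≢a  | no  z≢b  = cong (_+ 0) (𝟙-cong (z ∈? _) (z ∈? J) (mk⇔ ∈I⇒∈J ∈J⇒∈I))
    where
    ∈I⇒∈J : z ∈ (J - a) ∪ ⁅ b ⁆ → z ∈ J
    ∈I⇒∈J z∈ with x∈p∪q⁻ (J - a) ⁅ b ⁆ z∈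
    ... | inj₁ z∈J-a = p─q⊆p J ⁅ a ⁆ z∈J-a
    ... | inj₂ z∈⁅b⁆ = contradiction (x∈⁅y⁆⇒x≡y b z∈⁅b⁆) z≢b
    ∈J⇒∈I : z ∈ J → z ∈ (J - a) ∪ ⁅ b ⁆
    ∈J⇒∈I z∈J = x∈p∪q⁺ (inj₁ (x∈p∧x≢y⇒x∈p-y z∈J z≢a))

  ∣J-a∪b∣≡∣J∣ : ∣ (J - a) ∪ ⁅ b ⁆ ∣ ≡ ∣ J ∣
  ∣J-a∪b∣≡∣J∣ = begin
    ∣ (J - a) ∪ ⁅ b ⁆ ∣ ≡⟨ ∣∣≡count ((J - a) ∪ ⁅ b ⁆) ⟩
    count (_∈? I)       ≡⟨ +-cancelʳ-≡ 1 _ _ (begin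
      count (_∈? I) + 1                  ≡⟨ cong (count (_∈? I) +_) (count-≟ a) ⟨
      count (_∈? I) + count (Finₚ._≟ a)  ≡⟨ count-linear (_∈? I) (Finₚ._≟ a) (_∈? J) (Finₚ._≟ b) exchange-indicator ⟩
      count (_∈? J) + count (Finₚ._≟ b)  ≡⟨ cong (count (_∈? J) +_) (count-≟ b) ⟩
      count (_∈? J) + 1                  ∎) ⟩
    count (_∈? J)       ≡⟨ ∣∣≡count J ⟨
    ∣ J ∣               ∎
    where
    open ≡-Reasoning
    I = (J - a) ∪ ⁅ b ⁆

module _ {n} (w : Permutation′ n) where

  UpCross DownCross : Fin n → Pred (Fin n) 0ℓ
  UpCross   r z = r Fin.≤ z × w ⟨$⟩ˡ z Fin.< r
  DownCross r z = z Fin.< r × r Fin.≤ w ⟨$⟩ˡ z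

  upCross? : (r : Fin n) → Decidable (UpCross r)
  upCross? r z = (r ≤? z) ×-dec (w ⟨$⟩ˡ z <? r)

  downCross? : (r : Fin n) → Decidable (DownCross r)
  downCross? r z = (z <? r) ×-dec (r ≤? w ⟨$⟩ˡ z)

  -- Both sides equal #{z < r} − #{z < r : w⁻¹ z < r}.
  crossings-balance : ∀ r → count (upCross? r) ≡ count (downCross? r)
  crossings-balance r = +-cancelˡ-≡ (count <r?) _ _ (begin
    count <r? + count (upCross? r)
      ≡⟨ count-linear (<r? ∘ (w ⟨$⟩ˡ_)) (downCross? r) <r? (upCross? r)
           (λ z → by-sides (z <? r) (r ≤? z) (w ⟨$⟩ˡ z <? r) (r ≤? w ⟨$⟩ˡ z)) ⟨
    count (<r? ∘ (w ⟨$⟩ˡ_)) + count (downCross? r)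
      ≡⟨ cong (_+ count (downCross? r)) (sum-permute (𝟙 ∘ <r?) (Perm.flip w)) ⟨
    count <r? + count (downCross? r) ∎)
    where
    open ≡-Reasoning
    <r? : Decidable (Fin._< r)
    <r? z = z <? r
    by-sides : ∀ {x y : Fin n} (x<r : Dec (x Fin.< r)) (r≤x : Dec (r Fin.≤ x))
                               (y<r : Dec (y Fin.< r)) (r≤y : Dec (r Fin.≤ y)) →
               𝟙 y<r + 𝟙 (x<r ×-dec r≤y) ≡ 𝟙 x<r + 𝟙 (r≤x ×-dec y<r)
    by-sides (yes _) (no _)  (yes _) (no _)  = refl
    by-sides (yes _) (no _)  (no _)  (yes _) = refl
    by-sides (no _)  (yes _) (yes _) (no _)  = refl
    by-sides (no _)  (yes _) (no _)  (yes _) = refl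
    by-sides (yes x<r) (yes r≤x) _ _ = contradiction r≤x (<⇒≱ x<r)
    by-sides (no x≮r)  (no r≰x)  _ _ = contradiction (≮⇒≥ x≮r) r≰x
    by-sides _ _ (yes y<r) (yes r≤y) = contradiction r≤y (<⇒≱ y<r)
    by-sides _ _ (no y≮r)  (no r≰y)  = contradiction (≮⇒≥ y≮r) r≰y

  Ir-decomposition : ∀ r z → 𝟙 (z ∈? Ir w r) + 𝟙 (downCross? r z) ≡ 𝟙 (z ∈? I₁ w) + 𝟙 (upCross? r z)
  Ir-decomposition r z = begin
    𝟙 (z ∈? Ir w r) + 𝟙 (downCross? r z)
      ≡⟨ cong (_+ 𝟙 (downCross? r z)) (𝟙-∈?-tabulate (λ i → rank r i ℕ.<? rank r (w ⟨$⟩ˡ i)) z) ⟩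
    𝟙 rz<ry? + 𝟙 (downCross? r z)
      ≡⟨ by-sides (z <? r) (r ≤? z) (y <? r) (r ≤? y) ⟩
    𝟙 (z <? y) + 𝟙 (upCross? r z)
      ≡⟨ cong (_+ 𝟙 (upCross? r z)) (𝟙-∈?-tabulate (λ i → i <? w ⟨$⟩ˡ i) z) ⟨
    𝟙 (z ∈? I₁ w) + 𝟙 (upCross? r z) ∎
    where
    open ≡-Reasoning
    y = w ⟨$⟩ˡ z
    rz<ry? = rank r z ℕ.<? rank r y
    by-sides : (z<r : Dec (z Fin.< r)) (r≤z : Dec (r Fin.≤ z)) (y<r : Dec (y Fin.< r)) (r≤y : Dec (r Fin.≤ y)) →
               𝟙 rz<ry? + 𝟙 (z<r ×-dec r≤y) ≡ 𝟙 (z <? y) + 𝟙 (r≤z ×-dec y<r)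
    by-sides (yes z<r) (no _) (yes y<r) (no _) = cong (_+ 0) (𝟙-cong rz<ry? (z <? y) (rank-<⇔-< r z<r y<r))
    by-sides (yes z<r) (no _) (no _) (yes r≤y) =
      trans (cong (_+ 1) (𝟙-no rz<ry? (<⇒≯ (rank-wrap r r≤y z<r))))
            (cong (_+ 0) (sym (𝟙-yes (z <? y) (<-≤-trans z<r r≤y))))
    by-sides (no _) (yes r≤z) (yes y<r) (no _) =
      trans (cong (_+ 0) (𝟙-yes rz<ry? (rank-wrap r r≤z y<r)))
            (cong (_+ 1) (sym (𝟙-no (z <? y) (<-asym (<-≤-trans y<r r≤z)))))
    by-sides (no _) (yes r≤z) (no _) (yes r≤y) = cong (_+ 0) (𝟙-cong rz<ry? (z <? y) (rank-<⇔-≥ r r≤z r≤y))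
    by-sides (yes z<r) (yes r≤z) _ _ = contradiction r≤z (<⇒≱ z<r)
    by-sides (no z≮r)  (no r≰z)  _ _ = contradiction (≮⇒≥ z≮r) r≰z
    by-sides _ _ (yes y<r) (yes r≤y) = contradiction r≤y (<⇒≱ y<r)
    by-sides _ _ (no y≮r)  (no r≰y)  = contradiction (≮⇒≥ y≮r) r≰y

  ∣Ir∣≡∣I₁∣ : ∀ r → ∣ Ir w r ∣ ≡ ∣ I₁ w ∣
  ∣Ir∣≡∣I₁∣ r = begin
    ∣ Ir w r ∣         ≡⟨ ∣∣≡count (Ir w r) ⟩
    count (_∈? Ir w r) ≡⟨ +-cancelʳ-≡ (count (downCross? r)) _ _ (begin
      count (_∈? Ir w r) + count (downCross? r)  ≡⟨ count-linear (_∈? Ir w r) (downCross? r) (_∈? I₁ w) (upCross? r)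
                                                                  (Ir-decomposition r) ⟩
      count (_∈? I₁ w) + count (upCross? r)      ≡⟨ cong (count (_∈? I₁ w) +_) (crossings-balance r) ⟩
      count (_∈? I₁ w) + count (downCross? r)    ∎) ⟩
    count (_∈? I₁ w)   ≡⟨ ∣∣≡count (I₁ w) ⟨
    ∣ I₁ w ∣           ∎
    where open ≡-Reasoning

private
  exchange-arith : ∀ {x y j α β d u} → x + α ≡ j + β → y + d ≡ j + u → x ≤ y ⇔ β + d ≤ α + u
  exchange-arith {x} {y} {j} {α} {β} {d} {u} x+α≡j+β y+d≡j+u =
    ⇔.trans (mk⇔ (+-monoˡ-≤ (α + d)) (+-cancelʳ-≤ (α + d) x y))
   (⇔.trans (mk⇔ (subst₂ _≤_ lhs rhs) (subst₂ _≤_ (sym lhs) (sym rhs)))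
            (mk⇔ (+-cancelˡ-≤ j _ _) (+-monoʳ-≤ j)))
    where
    open ≡-Reasoning
    lhs : x + (α + d) ≡ j + (β + d)
    lhs = begin
      x + (α + d) ≡⟨ +-assoc x α d ⟨
      x + α + d   ≡⟨ cong (_+ d) x+α≡j+β ⟩
      j + β + d   ≡⟨ +-assoc j β d ⟩
      j + (β + d) ∎
    rhs : y + (α + d) ≡ j + (α + u)
    rhs = begin
      y + (α + d) ≡⟨ cong (y +_) (+-comm α d) ⟩
      y + (d + α) ≡⟨ +-assoc y d α ⟨
      y + d + α   ≡⟨ cong (_+ α) y+d≡j+u ⟩
      j + u + α   ≡⟨ +-assoc j u α ⟩
      j + (u + α) ≡⟨ cong (j +_) (+-comm u α) ⟩
      j + (α + u) ∎

module Exchange {n} (w : Permutation′ n) {a b : Fin n} (a∈J : a ∈ I₁ w) (b∉J : b ∉ I₁ w) where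

  private
    J I : Subset n
    J = I₁ w
    I = (J - a) ∪ ⁅ b ⁆

  -- The Gale inequality |I ∩ F| ≤ |I_r(w) ∩ F| for the first t elements F of <_r,
  -- with the common part I₁(w) ∩ F cancelled.
  Dominated : Fin n → ℕ → Set
  Dominated r t = 𝟙 (first? r t b) + count (downCross? w r ∩? first? r t) ≤
                  𝟙 (first? r t a) + count (upCross? w r ∩? first? r t)

  Ir⪯I⇔dominated : ∀ r → Ir w r ⪯[ r ] I ⇔ (∀ t → Dominated r t)
  Ir⪯I⇔dominated r = ⇔.trans (⪯⇔∣∣≡×count≥ r (Ir w r) I)
    (mk⇔ (λ (_ , I≤Ir) t → Equivalence.to (I≤Ir⇔dominated t) (I≤Ir t))
         (λ dominated → trans (∣Ir∣≡∣I₁∣ w r) (sym (∣J-a∪b∣≡∣J∣ a∈J b∉J)) ,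
                        λ t → Equivalence.from (I≤Ir⇔dominated t) (dominated t)))
    where
    I≤Ir⇔dominated : ∀ t → count ((_∈? I) ∩? first? r t) ≤ count ((_∈? Ir w r) ∩? first? r t) ⇔
                           Dominated r t
    I≤Ir⇔dominated t = exchange-arith
      (begin
        count ((_∈? I) ∩? first? r t) + 𝟙 (first? r t a)
          ≡⟨ cong (count ((_∈? I) ∩? first? r t) +_) (count-≟∩ a (first? r t)) ⟨
        count ((_∈? I) ∩? first? r t) + count ((Finₚ._≟ a) ∩? first? r t)
          ≡⟨ count-linear-∩ (_∈? I) (Finₚ._≟ a) (_∈? J) (Finₚ._≟ b) (exchange-indicator a∈J b∉J) (first? r t) ⟩
        count ((_∈? J) ∩? first? r t) + count ((Finₚ._≟ b) ∩? first? r t)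
          ≡⟨ cong (count ((_∈? J) ∩? first? r t) +_) (count-≟∩ b (first? r t)) ⟩
        count ((_∈? J) ∩? first? r t) + 𝟙 (first? r t b) ∎)
      (count-linear-∩ (_∈? Ir w r) (downCross? w r) (_∈? J) (upCross? w r) (Ir-decomposition w r) (first? r t))
      where open ≡-Reasoning

  positroid⇔dominated : I ∈Positroid w ⇔ (∀ r t → Dominated r t)
  positroid⇔dominated = mk⇔
    (λ (_ , Ir⪯I) r → Equivalence.to (Ir⪯I⇔dominated r) (Ir⪯I r))
    (λ dominated → ∣J-a∪b∣≡∣J∣ a∈J b∉J , λ r → Equivalence.from (Ir⪯I⇔dominated r) (dominated r))

  module _ {r : Fin n} {t : ℕ} where

    private
      #down #up : ℕ
      #down = count (downCross? w r ∩? first? r t)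
      #up   = count (upCross? w r ∩? first? r t)

    dominated-intro : #down ≤ #up → (First r t b → ¬ First r t a → suc #down ≤ #up) → Dominated r t
    dominated-intro #down≤#up straddling with first? r t b | first? r t a
    ... | no ¬Fb | _      = subst (λ β → β + #down ≤ 𝟙 (first? r t a) + #up) (sym (𝟙-no (first? r t b) ¬Fb))
                                (≤-trans #down≤#up (m≤n+m #up _))
    ... | yes Fb | yes Fa = subst₂ (λ β α → β + #down ≤ α + #up)
                                (sym (𝟙-yes (first? r t b) Fb)) (sym (𝟙-yes (first? r t a) Fa)) (s≤s #down≤#up)
    ... | yes Fb | no ¬Fa = subst₂ (λ β α → β + #down ≤ α + #up)
                                (sym (𝟙-yes (first? r t b) Fb)) (sym (𝟙-no (first? r t a) ¬Fa)) (straddling Fb ¬Fa)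

    dominated-short : toℕ r + t ≤ n → (First r t b → ¬ First r t a → ∃[ y ] UpCross w r y × First r t y) →
                      Dominated r t
    dominated-short short up-witness = dominated-intro (subst (_≤ #up) (sym #down≡0) z≤n) λ Fb ¬Fa →
      subst (λ d → suc d ≤ #up) (sym #down≡0)
            (1≤count (upCross? w r ∩? first? r t) (proj₂ (up-witness Fb ¬Fa)))
      where
      #down≡0 : #down ≡ 0
      #down≡0 = count-none (downCross? w r ∩? first? r t)
                           (λ z ((z<r , _) , Fz) → <⇒≱ z<r (first-short r short Fz))

    dominated-long : n ≤ toℕ r + t → (First r t b → ¬ First r t a → ∃[ x ] DownCross w r x × ¬ First r t x) →
                     Dominated r t
    dominated-long long down-witness =
      dominated-intro (subst (#down ≤_) (sym #up≡) (count-∩≤ (downCross? w r) (first? r t))) λ Fb ¬Fa →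
        let x , down-x , ¬Fx = down-witness Fb ¬Fa in
        subst (suc #down ≤_) (sym #up≡) (count-∩< (downCross? w r) (first? r t) down-x ¬Fx)
      where
      #up≡ : #up ≡ count (downCross? w r)
      #up≡ = trans (⊆⇒count-∩≡count (upCross? w r) (first? r t) (λ (r≤z , _) → first-long r long r≤z))
                   (crossings-balance w r)

    module _ (Fb : First r t b) (¬Fa : ¬ First r t a) where

      dominated⇒#down<#up : Dominated r t → suc #down ≤ #up
      dominated⇒#down<#up =
        subst₂ (λ β α → β + #down ≤ α + #up) (𝟙-yes (first? r t b) Fb) (𝟙-no (first? r t a) ¬Fa)

      dominated⇒upCross : Dominated r t → ∃[ y ] UpCross w r y × First r t y
      dominated⇒upCross dominated =
        0<count⇒∃ (upCross? w r ∩? first? r t) (≤-trans (s≤s z≤n) (dominated⇒#down<#up dominated))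

      dominated⇒downCross : Dominated r t → ∃[ x ] DownCross w r x × ¬ First r t x
      dominated⇒downCross dominated = count-∩<⇒∃ (downCross? w r) (first? r t) (begin-strict
        #down                  <⟨ dominated⇒#down<#up dominated ⟩
        #up                    ≤⟨ count-∩≤ (upCross? w r) (first? r t) ⟩
        count (upCross? w r)   ≡⟨ crossings-balance w r ⟩
        count (downCross? w r) ∎)
        where open ≤-Reasoning

  Cond₁ Cond₂ : Fin n → Set
  Cond₁ r = ∃[ x ] (a Fin.≤ x × x Fin.< r × r Fin.≤ w ⟨$⟩ˡ x)
  Cond₂ r = ∃[ y ] (r Fin.≤ y × y Fin.≤ b × w ⟨$⟩ˡ y Fin.< r)

  -- At r = 1 the order <_r is the natural order, and no element crosses up into [1, n].
  dominated⇒a<b : (∀ r t → Dominated r t) → a Fin.< b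
  dominated⇒a<b dominated = decide-a (first? r₀ (suc (toℕ b)) a)
    where
    r₀ : Fin n
    r₀ = Fin.fromℕ< (≤-<-trans z≤n (Finₚ.toℕ<n a))
    r₀≡0 : toℕ r₀ ≡ 0
    r₀≡0 = Finₚ.toℕ-fromℕ< _
    rank₀ : ∀ z → rank r₀ z ≡ toℕ z
    rank₀ z = trans (sym (+-identityʳ _)) (trans (cong (rank r₀ z +_) (sym r₀≡0))
                (rank-≥ r₀ (subst (_≤ toℕ z) (sym r₀≡0) z≤n)))
    decide-a : Dec (First r₀ (suc (toℕ b)) a) → a Fin.< b
    decide-a (yes Fa) = Finₚ.≤∧≢⇒< (s≤s⁻¹ (subst (_< suc (toℕ b)) (rank₀ a) Fa)) λ { refl → b∉J a∈J }
    decide-a (no ¬Fa) =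
      let y , (_ , wy<r₀) , _ = dominated⇒upCross (subst (_< suc (toℕ b)) (sym (rank₀ b)) ≤-refl) ¬Fa
                                                   (dominated r₀ (suc (toℕ b))) in
      contradiction (subst (toℕ (w ⟨$⟩ˡ y) <_) r₀≡0 wy<r₀) λ ()

  module _ {r : Fin n} (a<r : a Fin.< r) (r≤b : r Fin.≤ b) (dominated : ∀ t → Dominated r t) where

    dominated⇒cond₁ : Cond₁ r
    dominated⇒cond₁ =
      let x , (x<r , r≤wx) , ¬Fx =
            dominated⇒downCross (rank-wrap r r≤b a<r) (<-irrefl refl) (dominated (rank r a)) in
      x , Equivalence.to (rank-≤⇔-< r a<r x<r) (≮⇒≥ ¬Fx) , x<r , r≤wx

    dominated⇒cond₂ : Cond₂ r
    dominated⇒cond₂ =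
      let y , (r≤y , wy<r) , Fy =
            dominated⇒upCross ≤-refl (λ ra≤rb → <⇒≱ (rank-wrap r r≤b a<r) (s≤s⁻¹ ra≤rb)) (dominated (suc (rank r b))) in
      y , r≤y , Equivalence.to (rank-≤⇔-≥ r r≤y r≤b) (s≤s⁻¹ Fy) , wy<r

  conds⇒dominated : a Fin.< b → (∀ r → a Fin.< r → r Fin.≤ b → Cond₁ r × Cond₂ r) → ∀ r t → Dominated r t
  conds⇒dominated a<b conds r t = [ short-window , long-window ]′ (≤-total (toℕ r + t) n)
    where
    straddles : First r t b → ¬ First r t a → a Fin.< r × r Fin.≤ b
    straddles Fb ¬Fa = rank-<-inversion r a<b (<-≤-trans Fb (≮⇒≥ ¬Fa))
    short-window : toℕ r + t ≤ n → Dominated r t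
    short-window short = dominated-short short λ Fb ¬Fa →
      let a<r , r≤b = straddles Fb ¬Fa
          y , r≤y , y≤b , wy<r = proj₂ (conds r a<r r≤b) in
      y , (r≤y , wy<r) , ≤-<-trans (Equivalence.from (rank-≤⇔-≥ r r≤y r≤b) y≤b) Fb
    long-window : n ≤ toℕ r + t → Dominated r t
    long-window long = dominated-long long λ Fb ¬Fa →
      let a<r , r≤b = straddles Fb ¬Fa
          x , a≤x , x<r , r≤wx = proj₁ (conds r a<r r≤b) in
      x , (x<r , r≤wx) , λ Fx → ¬Fa (≤-<-trans (Equivalence.from (rank-≤⇔-< r a<r x<r) a≤x) Fx)

lemma3p4 : ∀ {n} (w : Permutation′ n) → IsDerangement w →
    (a b : Fin n) → a ∈ I₁ w → b ∉ I₁ w →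
    (((I₁ w - a) ∪ ⁅ b ⁆) ∈Positroid w) ⇔
      ((a Fin.< b) ×
       (∀ (r : Fin n) → a Fin.< r → r Fin.≤ b →
          (∃[ x ] (a Fin.≤ x × x Fin.< r × r Fin.≤ (w ⟨$⟩ˡ x))) ×
          (∃[ y ] (r Fin.≤ y × y Fin.≤ b × (w ⟨$⟩ˡ y) Fin.< r))))
lemma3p4 w _ a b a∈J b∉J = ⇔.trans positroid⇔dominated (mk⇔
  (λ dominated → dominated⇒a<b dominated ,
                 λ r a<r r≤b → dominated⇒cond₁ a<r r≤b (dominated r) , dominated⇒cond₂ a<r r≤b (dominated r))
  (λ (a<b , conds) → conds⇒dominated a<b conds))
  where open Exchange w a∈J b∉J
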